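{- Let $t\ge 2$, $A=\{0,1,\ldots,t-1\}$, let $s>1$ and $n\ge s$ be integers, and let $P$ be a preference function of span $s-1$ whose induced least preference function $g$ satisfies $g(0^{s-1})=0^{s-1}$ and has no cycles other than this self-loop (for every $x\in A^{s-1}\setminus\{0^{s-1}\}$ there is no $k\ge1$ with $g^k(x)=x$). Let $S$ be the sequence produced by Algorithm P with inputs $s,n,P$. Then the last $n$ symbols of $S$ form the word $a0^{n-1}$ for some $a\in A$ with $a\neq 0$.
   Context: A preference function $P$ of span $s-1$ assigns to each $\mathbf a\in A^{s-1}$ a vector $(P_1(\mathbf a),\ldots,P_t(\mathbf a))$ whose entries form a permutation of $A$. Its least preference function is $g(a_1,\ldots,a_{s-1})=(a_2,\ldots,a_{s-1},P_t(a_1,\ldots,a_{s-1}))$. $0^m$ denotes the word of $m$ zeros. Algorithm P produces a finite sequence $(a_i)$: $a_1=\cdots=a_n=0$; if $a_{N+1},\ldots,a_{N+n-1}$ have been defined (starting with $N=1$), set $a_{N+n}=P_i(a_{N+n-s+1},\ldots,a_{N+n-1})$ where $i\in\{1,\ldots,t\}$ is the smallest index such that the word $(a_{N+1},\ldots,a_{N+n-1},P_i(a_{N+n-s+1},\ldots,a_{N+n-1}))$ has not previously appeared as a block of contiguous symbols of the sequence; if no such $i$ exists, the sequence ends at $a_{N+n-1}$. -}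

module Defs where

open import Data.Nat using (ℕ; zero; suc; _∸_; _≤_; s≤s; z≤n)
open import Data.Fin using (Fin; fromℕ) renaming (zero to fzero; _<_ to _<ᶠ_)
open import Data.Fin.Permutation using (Permutation′; _⟨$⟩ʳ_)
open import Data.Vec using (Vec; []; _∷_) renaming (_∷ʳ_ to _∷ʳᵛ_; toList to vtoList)
open import Data.List using (List; []; _∷_; _++_; _∷ʳ_; drop; length; replicate)
open import Data.List.Relation.Binary.Infix.Heterogeneous using (Infix)
open import Data.Product using (Σ; _×_; _,_)
open import Relation.Binary.PropositionalEquality using (_≡_)
open import Relation.Nullary using (¬_)
open import Relation.Binary.Construct.Closure.ReflexiveTransitive using (Star)

0A : ∀ {t} → 2 ≤ t → Fin t
0A {suc _} _ = Data.Fin.zero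

-- The index t (the last preference), i.e. the element t-1 of Fin t:
-- preference P_i (i = 1..t) corresponds to the Fin-index i-1.
lastIdx : ∀ {t} → 2 ≤ t → Fin t
lastIdx {suc k} _ = fromℕ k

-- A preference function of span m on A = Fin t: to every a ∈ A^m a
-- permutation (P_1(a),...,P_t(a)) of A; P_i(a) = P a ⟨$⟩ʳ (i-1).
PreferenceFunction : ℕ → ℕ → Set
PreferenceFunction t m = Vec (Fin t) m → Permutation′ t

shift : ∀ {A : Set} {m} → Vec A m → A → Vec A m
shift []      x = []
shift (_ ∷ w) x = w ∷ʳᵛ x

leastPref : ∀ {t m} → 2 ≤ t → PreferenceFunction t m → Vec (Fin t) m → Vec (Fin t) m
leastPref ht P w = shift w (P w ⟨$⟩ʳ lastIdx ht)

iter : ∀ {A : Set} → (A → A) → ℕ → A → A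
iter f zero    x = x
iter f (suc k) x = f (iter f k x)

lastK : ∀ {A : Set} → ℕ → List A → List A
lastK k xs = drop (length xs ∸ k) xs

Appears : ∀ {A : Set} → List A → List A → Set
Appears u S = Infix _≡_ u S

module AlgorithmP {t : ℕ} (s n : ℕ) (P : PreferenceFunction t (s ∸ 1)) where

  word : List (Fin t) → Fin t → List (Fin t)
  word S x = lastK (n ∸ 1) S ∷ʳ x

  -- one step of Algorithm P: S is the current sequence a_1 … a_{N+n-1},
  -- w = (a_{N+n-s+1},…,a_{N+n-1}) its last s-1 symbols, i the smallest index
  -- such that word S (P_i(w)) has not appeared in S; S' = S extended by P_i(w).
  Step : List (Fin t) → List (Fin t) → Set
  Step S S' =
    Σ (List (Fin t)) λ pre → Σ (Vec (Fin t) (s ∸ 1)) λ w → S ≡ pre ++ vtoList w ×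
    Σ (Fin t) λ i →
      (∀ j → j <ᶠ i → Appears (word S (P w ⟨$⟩ʳ j)) S) ×
      ¬ Appears (word S (P w ⟨$⟩ʳ i)) S ×
      S' ≡ S ∷ʳ (P w ⟨$⟩ʳ i)

  Stops : List (Fin t) → Set
  Stops S = ∀ pre (w : Vec (Fin t) (s ∸ 1)) → S ≡ pre ++ vtoList w →
    ∀ i → Appears (word S (P w ⟨$⟩ʳ i)) S

  Produces : 2 ≤ t → List (Fin t) → Set
  Produces ht S = Star Step (replicate n (0A ht)) S × Stops S

module Submission where

-- Write m = n - 1.  Algorithm P starts from 0^n and only appends a symbol x when
-- the new block of length n (the last m symbols followed by x) is new, so along
-- the whole run two invariants hold: the sequence S begins with 0^n, and every
-- block of length n occurs in S at most once.  When the algorithm stops, every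
-- extension u x of the final window u (the last m symbols) already occurs in S.
-- Together with u itself at the end of S this gives t + 1 occurrences of u with
-- pairwise different continuations; two of them preceded by the same symbol would
-- be a repeated block of length n, so by the pigeonhole principle one occurrence of
-- u is at the start of S, whence u = 0^m.  The symbol a before the final window
-- cannot be 0 either: otherwise 0^n would occur at the end and at the start of S,
-- forcing S = 0^n, and 0^n does not stop because the block 0^m b with b ≠ 0 is new.

open import Defs
open import Data.Nat using (ℕ; zero; suc; _+_; _∸_; _≤_; _<_; s≤s; z≤n)
open import Data.Nat.Properties
  using (≤-trans; ≤-reflexive; <-irrefl; ∸-monoˡ-≤; m+n∸n≡m; m∸[m∸n]≡n; n≤1+n; n<1+n; suc-injective; +-comm; module ≤-Reasoning)
open import Data.Fin using (Fin; _≟_) renaming (zero to fzero; suc to fsuc)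
open import Data.Fin.Properties using (pigeonhole; any?) renaming (<-irrefl to <ᶠ-irrefl)
open import Data.Fin.Permutation using (_⟨$⟩ʳ_; _⟨$⟩ˡ_; inverseʳ)
open import Data.List using (List; []; _∷_; _++_; _∷ʳ_; drop; take; length; replicate; initLast; _∷ʳ′_)
open import Data.List.Properties
  using (++-assoc; ++-identityʳ; ++-cancelˡ; ++-cancelʳ; ∷-injectiveˡ; ∷-injectiveʳ; ∷ʳ-injective; ∷ʳ-injectiveˡ;
         ∷ʳ-++; length-++; length-++-≤ˡ; length-++-≤ʳ; length-replicate; length-drop; take++drop≡id; ≡-dec)
open import Data.List.Relation.Binary.Infix.Heterogeneous using (MkView; toView; fromView)
open import Data.List.Relation.Binary.Pointwise using (Pointwise-≡⇒≡; ≡⇒Pointwise-≡)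
open import Data.List.Relation.Unary.All using (All) renaming (head to All-head)
open import Data.List.Relation.Unary.All.Properties using (++⁻ʳ; replicate⁺)
open import Data.Vec using (Vec; fromList) renaming (toList to vtoList)
import Data.Vec
open import Data.Vec.Properties using (toList∘fromList)
open import Data.Product using (Σ; ∃; _×_; _,_; proj₁; proj₂)
open import Data.Sum using (_⊎_; inj₁; inj₂)
open import Data.Empty using (⊥-elim)
open import Relation.Nullary using (¬_; yes; no; contradiction)
open import Relation.Binary.PropositionalEquality
open import Relation.Binary.Construct.Closure.ReflexiveTransitive using (Star; ε; _◅_)

module _ {A : Set} where

  Occurrence : List A → List A → Set
  Occurrence w S = Σ (List A) λ before → Σ (List A) λ after → S ≡ before ++ w ++ after

  appears⇒occurrence : ∀ {w S : List A} → Appears w S → Occurrence w S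
  appears⇒occurrence i with toView i
  ... | MkView before w≈inf after = before , after , cong (λ v → before ++ v ++ after) (sym (Pointwise-≡⇒≡ w≈inf))

  appears-in : ∀ (before w after : List A) → Appears w (before ++ w ++ after)
  appears-in before w after = fromView (MkView before (≡⇒Pointwise-≡ refl) after)

  UniqueBlocks : ℕ → List A → Set
  UniqueBlocks k S = ∀ w {p₁ q₁ p₂ q₂} → length w ≡ k →
    S ≡ p₁ ++ w ++ q₁ → S ≡ p₂ ++ w ++ q₂ → p₁ ≡ p₂

  ++-injective : ∀ (p₁ p₂ : List A) {w₁ w₂} → length p₁ ≡ length p₂ →
    p₁ ++ w₁ ≡ p₂ ++ w₂ → p₁ ≡ p₂ × w₁ ≡ w₂
  ++-injective []       []       _ e = refl , e
  ++-injective (x ∷ p₁) (y ∷ p₂) l e with ++-injective p₁ p₂ (suc-injective l) (∷-injectiveʳ e)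
  ... | refl , e′ = cong (_∷ p₁) (∷-injectiveˡ e) , e′

  snoc-view : ∀ (xs : List A) → xs ≢ [] → Σ (List A) λ init → Σ A λ a → xs ≡ init ∷ʳ a
  snoc-view xs xs≢[] with initLast xs
  ... | []            = ⊥-elim (xs≢[] refl)
  ... | init ∷ʳ′ a    = init , a , refl

  symbol-before : ∀ {S : List A} q₀ u → S ≡ q₀ ++ u → length u < length S →
    Σ (List A) λ pre → Σ A λ a → S ≡ pre ++ a ∷ u
  symbol-before q₀ u e l with initLast q₀
  ... | []           = contradiction l (<-irrefl (sym (cong length e)))
  ... | pre ∷ʳ′ a    = pre , a , trans e (∷ʳ-++ pre a u)

  replicate-suc-++ : ∀ k (z : A) r → replicate (suc k) z ++ r ≡ replicate k z ++ z ∷ r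
  replicate-suc-++ zero    z r = refl
  replicate-suc-++ (suc k) z r = cong (z ∷_) (replicate-suc-++ k z r)

  symbol-of-replicate : ∀ k (z : A) p y q → replicate k z ≡ p ++ y ∷ q → y ≡ z
  symbol-of-replicate k z p y q e = All-head (++⁻ʳ p (subst (All (_≡ z)) e (replicate⁺ k refl)))

  lastK-++ : ∀ {k} (p w : List A) → length w ≡ k → lastK k (p ++ w) ≡ w
  lastK-++ p w refl = begin
      drop (length (p ++ w) ∸ length w) (p ++ w)
    ≡⟨ cong (λ i → drop (i ∸ length w) (p ++ w)) (length-++ p) ⟩
      drop (length p + length w ∸ length w) (p ++ w)
    ≡⟨ cong (λ i → drop i (p ++ w)) (m+n∸n≡m (length p) (length w)) ⟩
      drop (length p) (p ++ w)
    ≡⟨ drop-prefix p ⟩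
      w
    ∎
    where
    open ≡-Reasoning
    drop-prefix : ∀ p → drop (length p) (p ++ w) ≡ w
    drop-prefix []      = refl
    drop-prefix (_ ∷ p) = drop-prefix p

  lastK-split : ∀ k (S : List A) → k ≤ length S →
    S ≡ take (length S ∸ k) S ++ lastK k S × length (lastK k S) ≡ k
  lastK-split k S k≤ = sym (take++drop≡id (length S ∸ k) S)
                     , trans (length-drop (length S ∸ k) S) (m∸[m∸n]≡n k≤)

  as-vec : ∀ {k} (xs : List A) → length xs ≡ k → Σ (Vec A k) λ v → vtoList v ≡ xs
  as-vec xs refl = fromList xs , toList∘fromList xs

  lastK-vec : ∀ k (S : List A) → k ≤ length S →
    Σ (List A) λ pre → Σ (Vec A k) λ w → S ≡ pre ++ vtoList w
  lastK-vec k S k≤ =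
    let (S≡ , length≡k) = lastK-split k S k≤
        (w , w≡)        = as-vec (lastK k S) length≡k
    in take (length S ∸ k) S , w , trans S≡ (cong (take (length S ∸ k) S ++_) (sym w≡))

  full-length-at-start : ∀ {S : List A} p w q → length S ≡ length w → S ≡ p ++ w ++ q → p ≡ []
  full-length-at-start []      w q _ _ = refl
  full-length-at-start (a ∷ p) w q l e = contradiction longer (<-irrefl refl)
    where
    longer : length w < length w
    longer = subst (suc (length w) ≤_) (trans (cong length (sym e)) l)
                   (s≤s (≤-trans (length-++-≤ˡ w) (length-++-≤ʳ (w ++ q) {p})))

  whole-list-unique : ∀ {k} {S : List A} → length S ≡ k → UniqueBlocks k S
  whole-list-unique lS w lw e₁ e₂ =
    trans (full-length-at-start _ w _ (trans lS (sym lw)) e₁) (sym (full-length-at-start _ w _ (trans lS (sym lw)) e₂))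

  snoc-occurrence : ∀ (S : List A) x p w q → S ∷ʳ x ≡ p ++ w ++ q →
    (S ∷ʳ x ≡ p ++ w) ⊎ Σ (List A) (λ q′ → S ≡ p ++ w ++ q′)
  snoc-occurrence S x p w q e with initLast q
  ... | []          = inj₁ (trans e (cong (p ++_) (++-identityʳ w)))
  ... | q′ ∷ʳ′ y    = inj₂ (q′ , ∷ʳ-injectiveˡ S (p ++ w ++ q′) (trans e reassociate))
    where
    reassociate : p ++ w ++ (q′ ∷ʳ y) ≡ (p ++ w ++ q′) ∷ʳ y
    reassociate = trans (cong (p ++_) (sym (++-assoc w q′ (y ∷ [])))) (sym (++-assoc p (w ++ q′) (y ∷ [])))

  final-block : ∀ m (S : List A) x p w → length w ≡ suc m → S ∷ʳ x ≡ p ++ w → w ≡ lastK m S ∷ʳ x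
  final-block m S x p w l e with initLast w
  ... | []          = contradiction l λ ()
  ... | w′ ∷ʳ′ y with ∷ʳ-injective S (p ++ w′) (trans e (sym (++-assoc p w′ (y ∷ []))))
  ... | S≡pw′ , refl = cong (_∷ʳ x) (sym (trans (cong (lastK m) S≡pw′) (lastK-++ p w′ length-w′)))
    where
    length-w′ : length w′ ≡ m
    length-w′ = suc-injective (trans (trans (+-comm 1 (length w′)) (sym (length-++ w′))) l)

  final-block-reappears : ∀ m (S : List A) x p w p′ q′ → length w ≡ suc m →
    S ∷ʳ x ≡ p ++ w → S ≡ p′ ++ w ++ q′ → Appears (lastK m S ∷ʳ x) S
  final-block-reappears m S x p w p′ q′ l final inside =
    subst₂ Appears (final-block m S x p w l final) (sym inside) (appears-in p′ w q′)

  snoc-unique : ∀ m (S : List A) x → UniqueBlocks (suc m) S → ¬ Appears (lastK m S ∷ʳ x) S →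
    UniqueBlocks (suc m) (S ∷ʳ x)
  snoc-unique m S x unique fresh w {p₁} {q₁} {p₂} {q₂} l e₁ e₂
    with snoc-occurrence S x p₁ w q₁ e₁ | snoc-occurrence S x p₂ w q₂ e₂
  ... | inj₂ (_ , inside₁) | inj₂ (_ , inside₂) = unique w l inside₁ inside₂
  ... | inj₁ final₁        | inj₁ final₂        = ++-cancelʳ w p₁ p₂ (trans (sym final₁) final₂)
  ... | inj₁ final₁        | inj₂ (q , inside₂) = contradiction (final-block-reappears m S x p₁ w p₂ q l final₁ inside₂) fresh
  ... | inj₂ (q , inside₁) | inj₁ final₂        = contradiction (final-block-reappears m S x p₂ w p₁ q l final₂ inside₁) fresh

module _ {t : ℕ} where

  -- Pigeonhole: if a word u of length m occurs at t + 1 distinct positions of S and the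
  -- blocks of length m + 1 of S are unique, not every occurrence is preceded by a
  -- symbol, since two would be preceded by the same one and form a repeated block.
  not-all-preceded : ∀ {m} {S u : List (Fin t)} → UniqueBlocks (suc m) S → length u ≡ m →
    (before after : Fin (suc t) → List (Fin t)) → (∀ k → S ≡ before k ++ u ++ after k) →
    (∀ i j → before i ≡ before j → i ≡ j) → ¬ (∀ k → before k ≢ [])
  not-all-preceded {S = S} {u} unique lu before after occurs distinct nonempty =
    <ᶠ-irrefl (distinct i j same-before) i<j
    where
    init : Fin (suc t) → List (Fin t)
    init k = proj₁ (snoc-view (before k) (nonempty k))
    preceding : Fin (suc t) → Fin t
    preceding k = proj₁ (proj₂ (snoc-view (before k) (nonempty k)))
    before≡ : ∀ k → before k ≡ init k ∷ʳ preceding k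
    before≡ k = proj₂ (proj₂ (snoc-view (before k) (nonempty k)))
    longer-occurrence : ∀ k → S ≡ init k ++ (preceding k ∷ u) ++ after k
    longer-occurrence k = trans (occurs k)
      (trans (cong (_++ u ++ after k) (before≡ k)) (∷ʳ-++ (init k) (preceding k) (u ++ after k)))
    collision = pigeonhole (n<1+n t) preceding
    i j : Fin (suc t)
    i = proj₁ collision
    j = proj₁ (proj₂ collision)
    i<j = proj₁ (proj₂ (proj₂ collision))
    same : preceding i ≡ preceding j
    same = proj₂ (proj₂ (proj₂ collision))
    same-init : init i ≡ init j
    same-init = unique (preceding i ∷ u) (cong suc lu) (longer-occurrence i)
      (subst (λ a → S ≡ init j ++ (a ∷ u) ++ after j) (sym same) (longer-occurrence j))
    same-before : before i ≡ before j
    same-before = trans (before≡ i) (trans (cong₂ _∷ʳ_ same-init same) (sym (before≡ j)))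

  -- If u is a suffix of S and every extension u ∷ʳ x appears in S, then u is a prefix
  -- of S: these are t + 1 occurrences of u with different continuations.
  extensions⇒prefix : ∀ {m} {S q₀ u : List (Fin t)} → UniqueBlocks (suc m) S → length u ≡ m →
    S ≡ q₀ ++ u → (∀ x → Appears (u ∷ʳ x) S) → Σ (List (Fin t)) λ q → S ≡ u ++ q
  extensions⇒prefix {S = S} {q₀} {u} unique lu final extensions =
    after k₀ , subst (λ p → S ≡ p ++ u ++ after k₀) at-start (occurs k₀)
    where
    extension : ∀ x → Occurrence (u ∷ʳ x) S
    extension x = appears⇒occurrence (extensions x)
    -- occurrence 0 is the final one, occurrence x + 1 the one inside u ∷ʳ x
    before after : Fin (suc t) → List (Fin t)
    before fzero    = q₀
    before (fsuc x) = proj₁ (extension x)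
    after fzero    = []
    after (fsuc x) = x ∷ proj₁ (proj₂ (extension x))
    occurs : ∀ k → S ≡ before k ++ u ++ after k
    occurs fzero    = trans final (cong (q₀ ++_) (sym (++-identityʳ u)))
    occurs (fsuc x) = trans (proj₂ (proj₂ (extension x))) (cong (proj₁ (extension x) ++_) (∷ʳ-++ u x _))
    after-injective : ∀ i j → after i ≡ after j → i ≡ j
    after-injective fzero    fzero    _ = refl
    after-injective (fsuc x) (fsuc y) e = cong fsuc (∷-injectiveˡ e)
    distinct : ∀ i j → before i ≡ before j → i ≡ j
    distinct i j e = after-injective i j (++-cancelˡ u _ _ (++-cancelˡ (before i) _ _
      (trans (sym (occurs i)) (trans (occurs j) (cong (_++ u ++ after j) (sym e))))))
    found : ∃ λ k → before k ≡ []
    found with any? (λ k → ≡-dec _≟_ (before k) [])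
    ... | yes at-start = at-start
    ... | no none      = ⊥-elim (not-all-preceded unique lu before after occurs distinct (λ k e → none (k , e)))
    k₀ = proj₁ found
    at-start = proj₂ found

nonzero-symbol : ∀ {t} (ht : 2 ≤ t) → Σ (Fin t) λ b → b ≢ 0A ht
nonzero-symbol {suc (suc _)} (s≤s (s≤s z≤n)) = fsuc fzero , λ ()

module Run {t : ℕ} (ht : 2 ≤ t) (s m : ℕ) (P : PreferenceFunction t (s ∸ 1)) where
  open AlgorithmP s (suc m) P

  zeros : ℕ → List (Fin t)
  zeros k = replicate k (0A ht)

  record Invariant (S : List (Fin t)) : Set where
    field
      rest              : List (Fin t)
      starts-with-zeros : S ≡ zeros (suc m) ++ rest
      unique-blocks     : UniqueBlocks (suc m) S

  initial-invariant : Invariant (zeros (suc m))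
  initial-invariant = record
    { rest              = []
    ; starts-with-zeros = sym (++-identityʳ (zeros (suc m)))
    ; unique-blocks     = whole-list-unique (length-replicate (suc m))
    }

  step-invariant : ∀ {S S′} → Step S S′ → Invariant S → Invariant S′
  step-invariant {S} (_ , w , _ , i , _ , fresh , refl) inv = record
    { rest              = rest ∷ʳ x
    ; starts-with-zeros = trans (cong (_∷ʳ x) starts-with-zeros) (++-assoc (zeros (suc m)) rest (x ∷ []))
    ; unique-blocks     = snoc-unique m S x unique-blocks fresh
    }
    where
    open Invariant inv
    x = P w ⟨$⟩ʳ i

  run-invariant : ∀ {S S′} → Star Step S S′ → Invariant S → Invariant S′
  run-invariant ε          inv = inv
  run-invariant (step ◅ run) inv = run-invariant run (step-invariant step inv)

  invariant-length : ∀ {S} → Invariant S → suc m ≤ length S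
  invariant-length {S} inv = begin
      suc m                            ≡⟨ sym (length-replicate (suc m)) ⟩
      length (zeros (suc m))           ≤⟨ length-++-≤ˡ (zeros (suc m)) ⟩
      length (zeros (suc m) ++ rest)   ≡⟨ cong length (sym starts-with-zeros) ⟩
      length S                         ∎
    where
    open ≤-Reasoning
    open Invariant inv

  stops⇒extensions : ∀ {S} → s ∸ 1 ≤ length S → Stops S → ∀ x → Appears (lastK m S ∷ʳ x) S
  stops⇒extensions {S} window≤ stops x with lastK-vec (s ∸ 1) S window≤
  ... | pre , w , S≡ = subst (λ y → Appears (lastK m S ∷ʳ y) S) (inverseʳ (P w)) (stops pre w S≡ (P w ⟨$⟩ˡ x))

  -- 0^n does not stop: the block 0^m b with b ≠ 0 is still new.
  zeros-do-not-stop : s ∸ 1 ≤ m → ¬ Stops (zeros (suc m))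
  zeros-do-not-stop window≤ stops = b≢0 (symbol-of-replicate (suc m) (0A ht) (p ++ L) b q (trans S≡ reassociate))
    where
    b = proj₁ (nonzero-symbol ht)
    b≢0 = proj₂ (nonzero-symbol ht)
    L = lastK m (zeros (suc m))
    bound : s ∸ 1 ≤ length (zeros (suc m))
    bound = ≤-trans window≤ (≤-trans (n≤1+n m) (≤-reflexive (sym (length-replicate (suc m)))))
    occurrence = appears⇒occurrence (stops⇒extensions bound stops b)
    p = proj₁ occurrence
    q = proj₁ (proj₂ occurrence)
    S≡ = proj₂ (proj₂ occurrence)
    reassociate : p ++ (L ∷ʳ b) ++ q ≡ (p ++ L) ++ b ∷ q
    reassociate = trans (cong (p ++_) (∷ʳ-++ L b q)) (sym (++-assoc p L (b ∷ q)))

  module Stopped {S} (window≤ : s ∸ 1 ≤ m) (inv : Invariant S) (stops : Stops S) where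
    open Invariant inv

    m≤length : m ≤ length S
    m≤length = ≤-trans (n≤1+n m) (invariant-length inv)

    S≡q₀u : S ≡ take (length S ∸ m) S ++ lastK m S
    S≡q₀u = proj₁ (lastK-split m S m≤length)

    length-window : length (lastK m S) ≡ m
    length-window = proj₂ (lastK-split m S m≤length)

    window-is-prefix : Σ (List (Fin t)) λ q → S ≡ lastK m S ++ q
    window-is-prefix = extensions⇒prefix unique-blocks length-window S≡q₀u
                         (stops⇒extensions (≤-trans window≤ m≤length) stops)

    -- Hence the final window is 0^m, as S begins with 0^n.
    final-window : lastK m S ≡ zeros m
    final-window = proj₁ (++-injective (lastK m S) (zeros m) (trans length-window (sym (length-replicate m))) two-prefixes)
      where
      q = proj₁ window-is-prefix
      open ≡-Reasoning
      two-prefixes : lastK m S ++ q ≡ zeros m ++ 0A ht ∷ rest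
      two-prefixes = begin
        lastK m S ++ q           ≡⟨ sym (proj₂ window-is-prefix) ⟩
        S                        ≡⟨ starts-with-zeros ⟩
        zeros (suc m) ++ rest    ≡⟨ replicate-suc-++ m (0A ht) rest ⟩
        zeros m ++ 0A ht ∷ rest  ∎

    ends-with-window : Σ (List (Fin t)) λ pre → Σ (Fin t) λ a → S ≡ pre ++ a ∷ zeros m
    ends-with-window =
      let (pre , a , e) = symbol-before _ (lastK m S) S≡q₀u window-shorter
      in pre , a , trans e (cong (λ u → pre ++ a ∷ u) final-window)
      where
      window-shorter : length (lastK m S) < length S
      window-shorter = subst (_< length S) (sym length-window) (invariant-length inv)

    -- That symbol is not 0: otherwise the block 0^n at the end is the one at the start, so S = 0^n.
    preceding-nonzero : ∀ pre → S ≢ pre ++ 0A ht ∷ zeros m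
    preceding-nonzero pre e = zeros-do-not-stop window≤ (subst Stops (trans e (cong (_++ zeros (suc m)) pre≡[])) stops)
      where
      pre≡[] : pre ≡ []
      pre≡[] = unique-blocks (zeros (suc m)) (length-replicate (suc m))
        (trans e (cong (pre ++_) (sym (++-identityʳ (zeros (suc m)))))) starts-with-zeros

    result : Σ (List (Fin t)) λ pre → Σ (Fin t) λ a → a ≢ 0A ht × S ≡ pre ++ (a ∷ zeros m)
    result = let (pre , a , e) = ends-with-window in
      pre , a , (λ a≡0 → preceding-nonzero pre (subst (λ b → S ≡ pre ++ b ∷ zeros m) a≡0 e)) , e

mainTheorem4 : (t : ℕ) (ht : 2 ≤ t) (s n : ℕ) → 1 < s → s ≤ n →
    (P : PreferenceFunction t (s ∸ 1)) →
    leastPref ht P (Data.Vec.replicate (s ∸ 1) (0A ht)) ≡ Data.Vec.replicate (s ∸ 1) (0A ht) →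
    (∀ (x : Vec (Fin t) (s ∸ 1)) → x ≢ Data.Vec.replicate (s ∸ 1) (0A ht) →
      ∀ (k : ℕ) → 1 ≤ k → iter (leastPref ht P) k x ≢ x) →
    (S : List (Fin t)) → AlgorithmP.Produces s n P ht S →
    Σ (List (Fin t)) λ pre → Σ (Fin t) λ a →
      a ≢ 0A ht × S ≡ pre ++ (a ∷ replicate (n ∸ 1) (0A ht))
mainTheorem4 t ht s zero    1<s s≤0 = contradiction (≤-trans 1<s s≤0) λ ()
mainTheorem4 t ht s (suc m) _   s≤n P _ _ S (run , stops) = Stopped.result (∸-monoˡ-≤ 1 s≤n) invariant stops
  where
  open Run ht s m P
  invariant : Invariant S
  invariant = run-invariant run initial-invariant
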